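{- Let $G=(V,E)$ be a graph and $k\ge1$. Suppose $v_1,v_2,v_3,v_4$ are four distinct vertices such that, for $i\neq j$, $v_iv_j\in E$ if and only if $1\in\{i,j\}$, and moreover $d(v_1)=3$ and $d(v_4)=1$. Then $(G,k)$ is a yes-instance of \textsc{Cliques or Trees Vertex Deletion} if and only if $(G-v_4,k)$ is a yes-instance.
   Context: Graphs are undirected, without self-loops, possibly with multi-edges (parallel edges form a cycle). $d(v)$ is the number of edges incident to $v$ (counting multiplicities). A clique has exactly one edge between any two distinct vertices; a tree is connected and acyclic. \textsc{Cliques or Trees Vertex Deletion}: given $(G,k)$, decide whether there is $X\subseteq V$ with $|X|\le k$ such that every component of $G-X$ is a clique or a tree. -}

module Defs where

open import Data.Nat using (ℕ; zero; suc; _≤_; _<_)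
open import Data.Fin using (Fin; inject₁; fromℕ) renaming (zero to fzero; suc to fsuc)
open import Data.Fin.Subset using (Subset; _∈_; _∉_; _⊆_; ∣_∣)
open import Data.List using (map; allFin)
open import Data.Nat.ListAction using (sum)
open import Data.Product using (Σ; _×_; ∃)
open import Data.Sum using (_⊎_)
open import Relation.Binary.PropositionalEquality using (_≡_; _≢_)
open import Relation.Nullary using (¬_)
open import Function.Definitions using (Injective)

record MultiGraph (n : ℕ) : Set where
  field
    mult     : Fin n → Fin n → ℕ
    symmetric : ∀ u v → mult u v ≡ mult v u
    loopless : ∀ v → mult v v ≡ 0
open MultiGraph public

module _ {n : ℕ} (G : MultiGraph n) where

  deg : Fin n → ℕ
  deg v = sum (map (mult G v) (allFin n))

  Adj : Fin n → Fin n → Set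
  Adj u v = 0 < mult G u v

  data Reach (S : Fin n → Set) : Fin n → Fin n → Set where
    here : ∀ {v} → S v → Reach S v v
    step : ∀ {u w v} → S u → Adj u w → Reach S w v → Reach S u v

  IsClique : (Fin n → Set) → Set
  IsClique C = ∀ a b → C a → C b → a ≢ b → mult G a b ≡ 1

  -- C contains a cycle of the multigraph: a pair of parallel edges, or a cycle
  -- v₀ v₁ … v_{m+2} v₀ through at least 3 distinct vertices of C
  HasCycle : (Fin n → Set) → Set
  HasCycle C =
    (Σ (Fin n) λ a → Σ (Fin n) λ b → C a × C b × 2 ≤ mult G a b)
    ⊎ (Σ ℕ λ m → Σ (Fin (suc (suc (suc m))) → Fin n) λ cs →
         Injective _≡_ _≡_ cs
         × (∀ i → C (cs i))
         × (∀ (i : Fin (suc (suc m))) → Adj (cs (inject₁ i)) (cs (fsuc i)))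
         × Adj (cs (fromℕ (suc (suc m)))) (cs fzero))

  IsTree : (Fin n → Set) → Set
  IsTree C = (∀ a b → C a → C b → Reach C a b) × ¬ HasCycle C

  -- The component of G[V] - X containing v is {u | u reachable from v in G[V] - X}.
  YesCTVD : Subset n → ℕ → Set
  YesCTVD V k = Σ (Subset n) λ X → X ⊆ V × ∣ X ∣ ≤ k ×
    (∀ v → v ∈ V → v ∉ X →
      let C = λ u → Reach (λ w → w ∈ V × w ∉ X) v u
      in IsClique C ⊎ IsTree C)

{-# OPTIONS --safe #-}
module Submission where

-- Deleting a vertex preserves yes-instances, since components only shrink and cliques and
-- forests are hereditary. Conversely, a solution X for G - v₄ also works for G: v₄ is a
-- leaf hanging off v₁, so a component of G - X is a component D of G - v₄ - X, possibly
-- with v₄ attached to v₁ ∈ D. Attaching a leaf keeps D acyclic, and if D is a clique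
-- containing v₁ it has at most two vertices (v₁ lies on no triangle, as v₂, v₃, v₄ are
-- pairwise non-adjacent), so it is a tree as well.

open import Defs
open import Data.Nat using (ℕ; zero; suc; _+_; _≤_; _<_; _<ᵇ_; _<?_; z≤n; s≤s)
open import Data.Nat.Properties using (≤-trans; ≤-reflexive; m≤m+n; m≤n+m; 1+n≰n; n≮n; module ≤-Reasoning)
open import Data.Fin using (Fin; inject₁; fromℕ; _≟_) renaming (zero to fzero; suc to fsuc)
open import Data.Fin.Properties using (suc-injective)
open import Data.Fin.Relation.Unary.Top using (view; ‵fromℕ; ‵inject₁)
open import Data.Fin.Subset using (Subset; ⊤; _-_; _∩_; _∈_; _∉_; _⊆_; ∣_∣; ⁅_⁆)
open import Data.Fin.Subset.Properties
  using (⊆⊤; p─q⊆p; _∈?_; x∈p∧x≢y⇒x∈p-y; x∈p⇒∣p-x∣<∣p∣; p∩q⊆q; ∣p∩q∣≤∣p∣; x∈p∩q⁺)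
import Data.Vec.Base as Vec
open import Data.List using (List; []; _∷_; length; tabulate)
open import Data.List.Properties using (map-tabulate)
open import Data.List.Membership.Propositional using () renaming (_∈_ to _∈ₗ_)
open import Data.List.Relation.Unary.All as All using (All; []; _∷_)
open import Data.List.Relation.Unary.All.Properties using (¬Any⇒All¬)
open import Data.List.Relation.Unary.AllPairs using ([]; _∷_)
open import Data.List.Relation.Unary.Any using (here; there; any?)
open import Data.List.Relation.Unary.Unique.Propositional using (Unique)
open import Data.Nat.ListAction using (sum)
open import Data.Product as Product using (∃₂; _×_; _,_; proj₁; proj₂; uncurry)
open import Data.Sum as Sum using (_⊎_; inj₁; inj₂; [_,_]′)
open import Data.Empty using (⊥)
open import Function using (_∘_; id)
open import Function.Bundles using (_⇔_; mk⇔)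
open import Relation.Binary.PropositionalEquality using (_≡_; _≢_; refl; sym; trans; cong; subst)
open import Relation.Nullary using (¬_; Dec; yes; no; contradiction; ¬?; _×-dec_)

support : ∀ {n} → (Fin n → ℕ) → Subset n
support {zero}  f = Vec.[]
support {suc _} f = (0 <ᵇ f fzero) Vec.∷ support (f ∘ fsuc)

∈-support : ∀ {n} (f : Fin n → ℕ) {i} → 0 < f i → i ∈ support f
∈-support f {fzero} 0<fi with f fzero | 0<fi
... | suc _ | _ = Vec.here
∈-support f {fsuc i} 0<fi = Vec.there (∈-support (f ∘ fsuc) 0<fi)

∣support∣≤sum : ∀ {n} (f : Fin n → ℕ) → ∣ support f ∣ ≤ sum (tabulate f)
∣support∣≤sum {zero}  f = z≤n
∣support∣≤sum {suc _} f with f fzero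
... | zero  = ∣support∣≤sum (f ∘ fsuc)
... | suc m = s≤s (≤-trans (∣support∣≤sum (f ∘ fsuc)) (m≤n+m _ m))

≤-sum-tabulate : ∀ {n} (f : Fin n → ℕ) i → f i ≤ sum (tabulate f)
≤-sum-tabulate f fzero    = m≤m+n (f fzero) _
≤-sum-tabulate f (fsuc i) = ≤-trans (≤-sum-tabulate (f ∘ fsuc) i) (m≤n+m _ (f fzero))

Unique⇒length≤∣p∣ : ∀ {n} {p : Subset n} {is : List (Fin n)} →
                    Unique is → All (_∈ p) is → length is ≤ ∣ p ∣
Unique⇒length≤∣p∣ []              []             = z≤n
Unique⇒length≤∣p∣ {p = p} {i ∷ js} (i≢js ∷ js-uniq) (i∈p ∷ js∈p) =
  ≤-trans (s≤s (Unique⇒length≤∣p∣ js-uniq js∈p-i)) (x∈p⇒∣p-x∣<∣p∣ i∈p)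
  where
  js∈p-i : All (_∈ p - i) js
  js∈p-i = All.zipWith (λ (j∈p , i≢j) → x∈p∧x≢y⇒x∈p-y j∈p (i≢j ∘ sym)) (js∈p , i≢js)

inject₁²≢suc² : ∀ {m} (j : Fin m) → inject₁ (inject₁ j) ≢ fsuc (fsuc j)
inject₁²≢suc² fzero    ()
inject₁²≢suc² (fsuc j) = inject₁²≢suc² j ∘ suc-injective

module _ {n : ℕ} (G : MultiGraph n) where

  Adj-sym : ∀ {a b} → Adj G a b → Adj G b a
  Adj-sym {a} {b} = subst (0 <_) (symmetric G a b)

  Adj⇒≢ : ∀ {a b} → Adj G a b → a ≢ b
  Adj⇒≢ {a} a–a refl = n≮n 0 (subst (0 <_) (loopless G a) a–a)

  deg≡sum-tabulate : ∀ v → deg G v ≡ sum (tabulate (mult G v))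
  deg≡sum-tabulate v = cong sum (map-tabulate id (mult G v))

  mult≤deg : ∀ v u → mult G v u ≤ deg G v
  mult≤deg v u = subst (mult G v u ≤_) (sym (deg≡sum-tabulate v)) (≤-sum-tabulate (mult G v) u)

  distinct-neighbours≤deg : ∀ {v us} → Unique us → All (Adj G v) us → length us ≤ deg G v
  distinct-neighbours≤deg {v} {us} us-uniq v–us = begin
    length us                       ≤⟨ Unique⇒length≤∣p∣ us-uniq (All.map (∈-support (mult G v)) v–us) ⟩
    ∣ support (mult G v) ∣          ≤⟨ ∣support∣≤sum (mult G v) ⟩
    sum (tabulate (mult G v))       ≡⟨ deg≡sum-tabulate v ⟨
    deg G v                         ∎
    where open ≤-Reasoning

  neighbours-exhausted : ∀ {v us} → Unique us → All (Adj G v) us → deg G v ≤ length us →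
                         ∀ {a} → Adj G v a → a ∈ₗ us
  neighbours-exhausted {v} {us} us-uniq v–us deg≤ {a} v–a with any? (a ≟_) us
  ... | yes a∈us = a∈us
  ... | no  a∉us = contradiction
    (≤-trans (distinct-neighbours≤deg (¬Any⇒All¬ us a∉us ∷ us-uniq) (v–a ∷ v–us)) deg≤) 1+n≰n

  module _ {S : Fin n → Set} where

    Reach-source : ∀ {a b} → Reach G S a b → S a
    Reach-source (here sa)     = sa
    Reach-source (step sa _ _) = sa

    Reach-target : ∀ {a b} → Reach G S a b → S b
    Reach-target (here sb)    = sb
    Reach-target (step _ _ r) = Reach-target r

    Reach-trans : ∀ {a b c} → Reach G S a b → Reach G S b c → Reach G S a c
    Reach-trans (here _)       r′ = r′
    Reach-trans (step sa a–w r) r′ = step sa a–w (Reach-trans r r′)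

    Reach-sym : ∀ {a b} → Reach G S a b → Reach G S b a
    Reach-sym (here sa)       = here sa
    Reach-sym (step sa a–w r) = Reach-trans (Reach-sym r) (step (Reach-source r) (Adj-sym a–w) (here sa))

  Reach-mono : ∀ {S S′ : Fin n → Set} → (∀ {w} → S w → S′ w) → ∀ {a b} → Reach G S a b → Reach G S′ a b
  Reach-mono S⊆S′ (here sa)       = here (S⊆S′ sa)
  Reach-mono S⊆S′ (step sa a–w r) = step (S⊆S′ sa) a–w (Reach-mono S⊆S′ r)

  Component : (Fin n → Set) → Fin n → Fin n → Set
  Component S v u = Reach G S v u

  module _ {S : Fin n → Set} {v : Fin n} where

    Reach-in-component : ∀ {a b} → Component S v a → Reach G S a b → Reach G (Component S v) a b
    Reach-in-component v⇝a (here _)        = here v⇝a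
    Reach-in-component v⇝a (step sa a–w r) =
      step v⇝a a–w (Reach-in-component (Reach-trans v⇝a (step sa a–w (here (Reach-source r)))) r)

    component-connected : ∀ a b → Component S v a → Component S v b → Reach G (Component S v) a b
    component-connected a b v⇝a v⇝b = Reach-trans (Reach-sym (from-v v⇝a)) (from-v v⇝b)
      where
      from-v : ∀ {u} → Component S v u → Reach G (Component S v) v u
      from-v = Reach-in-component (here (Reach-source v⇝a))

    cliqueOrAcyclic⇒cliqueOrTree : IsClique G (Component S v) ⊎ ¬ HasCycle G (Component S v) →
                                   IsClique G (Component S v) ⊎ IsTree G (Component S v)
    cliqueOrAcyclic⇒cliqueOrTree = Sum.map₂ (component-connected ,_)

  Adj-in-clique : ∀ {C a b} → IsClique G C → C a → C b → a ≢ b → Adj G a b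
  Adj-in-clique {a = a} {b} C-clique ca cb a≢b = subst (0 <_) (sym (C-clique a b ca cb a≢b)) (s≤s z≤n)

  IsClique-antitone : ∀ {C D : Fin n → Set} → (∀ {u} → C u → D u) → IsClique G D → IsClique G C
  IsClique-antitone C⊆D D-clique a b ca cb = D-clique a b (C⊆D ca) (C⊆D cb)

  subsingleton-isClique : ∀ {C c} → (∀ {u} → C u → u ≡ c) → IsClique G C
  subsingleton-isClique ≡c a b ca cb a≢b = contradiction (trans (≡c ca) (sym (≡c cb))) a≢b

  HasCycle-mono : ∀ {C D : Fin n → Set} → (∀ {u} → C u → D u) → HasCycle G C → HasCycle G D
  HasCycle-mono C⊆D (inj₁ (a , b , ca , cb , 2≤ab)) = inj₁ (a , b , C⊆D ca , C⊆D cb , 2≤ab)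
  HasCycle-mono C⊆D (inj₂ (m , cs , cs-inj , cs∈C , edges , closing)) =
    inj₂ (m , cs , cs-inj , C⊆D ∘ cs∈C , edges , closing)

  cycle-neighbours : ∀ {m} (cs : Fin (3 + m) → Fin n) →
    (∀ i → Adj G (cs (inject₁ i)) (cs (fsuc i))) → Adj G (cs (fromℕ (2 + m))) (cs fzero) →
    ∀ i → ∃₂ λ j j′ → j ≢ j′ × Adj G (cs i) (cs j) × Adj G (cs i) (cs j′)
  cycle-neighbours cs edges closing fzero = fsuc fzero , fromℕ _ , (λ ()) , edges fzero , Adj-sym closing
  cycle-neighbours cs edges closing (fsuc i) with view i
  ... | ‵fromℕ     = inject₁ (fromℕ _) , fzero , (λ ()) , Adj-sym (edges (fromℕ _)) , closing
  ... | ‵inject₁ j = inject₁ (inject₁ j) , fsuc (fsuc j) , inject₁²≢suc² j ,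
                     Adj-sym (edges (inject₁ j)) , edges (fsuc j)

  OnNoTriangle : Fin n → Set
  OnNoTriangle q = ∀ {a b} → Adj G q a → Adj G q b → a ≢ b → ¬ Adj G a b

  clique-acyclic : ∀ {D q} → IsClique G D → D q → OnNoTriangle q → ¬ HasCycle G D
  clique-acyclic D-clique _ _ (inj₁ (a , b , da , db , 2≤ab)) with a ≟ b
  ... | yes refl = n≮n 0 (≤-trans (s≤s z≤n) (subst (2 ≤_) (loopless G a) 2≤ab))
  ... | no a≢b   = 1+n≰n (subst (2 ≤_) (D-clique a b da db a≢b) 2≤ab)
  clique-acyclic {D} {q} D-clique dq q-no△ (inj₂ (m , cs , cs-inj , cs∈D , _)) =
    no-three (cs∈D i₀) (cs∈D i₁) (cs∈D i₂)
             (distinct i₀ i₁ λ ()) (distinct i₀ i₂ λ ()) (distinct i₁ i₂ λ ())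
    where
    i₀ i₁ i₂ : Fin (3 + m)
    i₀ = fzero
    i₁ = fsuc fzero
    i₂ = fsuc (fsuc fzero)

    distinct : ∀ i j → i ≢ j → cs i ≢ cs j
    distinct _ _ i≢j = i≢j ∘ cs-inj

    no-two-others : ∀ {a b} → D a → D b → a ≢ q → b ≢ q → a ≢ b → ⊥
    no-two-others da db a≢q b≢q a≢b = q-no△
      (Adj-in-clique D-clique dq da (a≢q ∘ sym)) (Adj-in-clique D-clique dq db (b≢q ∘ sym))
      a≢b (Adj-in-clique D-clique da db a≢b)

    no-three : ∀ {a b c} → D a → D b → D c → a ≢ b → a ≢ c → b ≢ c → ⊥
    no-three {a} {b} da db dc a≢b a≢c b≢c with a ≟ q | b ≟ q
    ... | yes refl | _        = no-two-others db dc (a≢b ∘ sym) (a≢c ∘ sym) b≢c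
    ... | no a≢q   | yes refl = no-two-others da dc a≢q (b≢c ∘ sym) a≢c
    ... | no a≢q   | no b≢q   = no-two-others da db a≢q b≢q a≢b

  -- Reach is not decidable in general, but in a clique component it reduces to adjacency to w.
  clique-component-member? : ∀ {S w} → (∀ u → Dec (S u)) → S w → IsClique G (Component S w) →
                             ∀ u → Dec (Component S w u)
  clique-component-member? {S} {w} S? sw C-clique u with u ≟ w | S? u | 0 <? mult G w u
  ... | yes refl | _      | _       = yes (here sw)
  ... | no _     | no ¬su | _       = no (¬su ∘ Reach-target)
  ... | no _     | yes su | yes w–u = yes (step sw w–u (here su))
  ... | no u≢w   | yes _  | no w≁u  = no λ w⇝u → w≁u (Adj-in-clique C-clique (here sw) w⇝u (u≢w ∘ sym))

  YesCTVD-restrict : ∀ {V W k} → W ⊆ V → YesCTVD G V k → YesCTVD G W k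
  YesCTVD-restrict {V} {W} W⊆V (X , _ , ∣X∣≤k , X-solves) =
    X ∩ W , p∩q⊆q X W , ≤-trans (∣p∩q∣≤∣p∣ X W) ∣X∣≤k , solves
    where
    Alive : Fin n → Set
    Alive w = w ∈ W × w ∉ X ∩ W

    alive-in-V : ∀ {w} → Alive w → w ∈ V × w ∉ X
    alive-in-V (w∈W , w∉X∩W) = W⊆V w∈W , λ w∈X → w∉X∩W (x∈p∩q⁺ (w∈X , w∈W))

    solves : ∀ v → v ∈ W → v ∉ X ∩ W → IsClique G (Component Alive v) ⊎ IsTree G (Component Alive v)
    solves v v∈W v∉X∩W = cliqueOrAcyclic⇒cliqueOrTree (Sum.map
      (IsClique-antitone (Reach-mono alive-in-V))
      (λ tree → proj₂ tree ∘ HasCycle-mono (Reach-mono alive-in-V))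
      (uncurry (X-solves v) (alive-in-V (v∈W , v∉X∩W))))

module Leaf {n : ℕ} (G : MultiGraph n) {p q : Fin n} (p–q : Adj G p q) (deg-p≤1 : deg G p ≤ 1) where

  neighbour-of-leaf : ∀ {a} → Adj G p a → a ≡ q
  neighbour-of-leaf p–a with neighbours-exhausted G ([] ∷ []) (p–q ∷ []) deg-p≤1 p–a
  ... | here a≡q = a≡q

  q≢p : q ≢ p
  q≢p = Adj⇒≢ G p–q ∘ sym

  HasCycle-avoids-leaf : ∀ {E : Fin n → Set} → HasCycle G E → HasCycle G (λ u → E u × u ≢ p)
  HasCycle-avoids-leaf (inj₁ (a , b , ea , eb , 2≤ab)) = inj₁ (a , b , (ea , a≢p) , (eb , b≢p) , 2≤ab)
    where
    no-parallel-edges-at-p : ∀ b → ¬ 2 ≤ mult G p b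
    no-parallel-edges-at-p b 2≤pb = 1+n≰n (≤-trans 2≤pb (≤-trans (mult≤deg G p b) deg-p≤1))
    a≢p : a ≢ p
    a≢p refl = no-parallel-edges-at-p b 2≤ab
    b≢p : b ≢ p
    b≢p refl = no-parallel-edges-at-p a (subst (2 ≤_) (symmetric G a b) 2≤ab)
  HasCycle-avoids-leaf (inj₂ (m , cs , cs-inj , cs∈E , edges , closing)) =
    inj₂ (m , cs , cs-inj , (λ i → cs∈E i , cs≢p i) , edges , closing)
    where
    cs≢p : ∀ i → cs i ≢ p
    cs≢p i csi≡p with cycle-neighbours G cs edges closing i
    ... | j , j′ , j≢j′ , i–j , i–j′ = j≢j′ (cs-inj (trans (towards-q i–j) (sym (towards-q i–j′))))
      where
      towards-q : ∀ {a} → Adj G (cs i) a → a ≡ q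
      towards-q = neighbour-of-leaf ∘ subst (λ c → Adj G c _) csi≡p

  acyclic-addLeaf : ∀ {D E : Fin n → Set} →
                    ¬ HasCycle G D → (∀ {u} → E u → D u ⊎ u ≡ p) → ¬ HasCycle G E
  acyclic-addLeaf {D} {E} D-acyclic E⊆D+p = D-acyclic ∘ HasCycle-mono G in-D ∘ HasCycle-avoids-leaf
    where
    in-D : ∀ {u} → E u × u ≢ p → D u
    in-D (eu , u≢p) = [ id , (λ u≡p → contradiction u≡p u≢p) ]′ (E⊆D+p eu)

  clique-addLeaf : ∀ {D E : Fin n → Set} → OnNoTriangle G q → IsClique G D → Dec (D q) →
                   (∀ {u} → E u → D u ⊎ u ≡ p) → (E p → D q) → IsClique G E ⊎ ¬ HasCycle G E
  clique-addLeaf q-no△ D-clique (yes dq) E⊆D+p _ =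
    inj₂ (acyclic-addLeaf (clique-acyclic G D-clique dq q-no△) E⊆D+p)
  clique-addLeaf {D} {E} _ D-clique (no ¬dq) E⊆D+p ep⇒dq = inj₁ (IsClique-antitone G in-D D-clique)
    where
    in-D : ∀ {u} → E u → D u
    in-D eu with E⊆D+p eu
    ... | inj₁ du   = du
    ... | inj₂ refl = contradiction (ep⇒dq eu) ¬dq

  Reach-from-leaf : ∀ {S u} → Reach G S p u → u ≡ p ⊎ Reach G S q u
  Reach-from-leaf     (here _)         = inj₁ refl
  Reach-from-leaf {S} (step _ p–w w⇝u) = inj₂ (subst (λ w → Reach G S w _) (neighbour-of-leaf p–w) w⇝u)

  -- A walk entering the leaf p comes from q and, if it goes on, returns to q at once.
  Reach-avoiding-leaf : ∀ {S S′ : Fin n → Set} → (∀ {w} → S w → w ≢ p → S′ w) →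
    ∀ {a u} → a ≢ p → Reach G S a u → (Reach G S′ a u × u ≢ p) ⊎ (u ≡ p × Reach G S′ a q)
  Reach-avoiding-leaf S⇒S′ a≢p (here sa) = inj₁ (here (S⇒S′ sa a≢p) , a≢p)
  Reach-avoiding-leaf {S′ = S′} S⇒S′ {a} {u} a≢p (step {w = w} sa a–w w⇝u) with w ≟ p
  ... | no w≢p = Sum.map (Product.map₁ (step s′a a–w)) (Product.map₂ (step s′a a–w))
                         (Reach-avoiding-leaf S⇒S′ w≢p w⇝u)
    where
    s′a : S′ a
    s′a = S⇒S′ sa a≢p
  ... | yes refl with w⇝u
  ...   | here _ =
    inj₂ (refl , subst (Reach G S′ a) (neighbour-of-leaf (Adj-sym G a–w)) (here (S⇒S′ sa a≢p)))
  ...   | step _ p–w′ w′⇝u =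
    subst (λ c → (Reach G S′ c u × u ≢ p) ⊎ (u ≡ p × Reach G S′ c q))
          (trans (neighbour-of-leaf p–w′) (sym (neighbour-of-leaf (Adj-sym G a–w))))
          (Reach-avoiding-leaf S⇒S′ (Adj⇒≢ G p–w′ ∘ sym) w′⇝u)

  YesCTVD-addLeaf : ∀ {V k} → OnNoTriangle G q → YesCTVD G (V - p) k → YesCTVD G V k
  YesCTVD-addLeaf {V} q-no△ (X , X⊆V-p , ∣X∣≤k , X-solves) =
    X , p─q⊆p V ⁅ p ⁆ ∘ X⊆V-p , ∣X∣≤k ,
    λ v v∈V v∉X → cliqueOrAcyclic⇒cliqueOrTree G (cliqueOrAcyclic (v∈V , v∉X))
    where
    Alive Alive′ : Fin n → Set
    Alive  w = w ∈ V × w ∉ X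
    Alive′ w = w ∈ V - p × w ∉ X

    alive? : ∀ w → Dec (Alive w)
    alive? w = (w ∈? V) ×-dec ¬? (w ∈? X)

    alive′? : ∀ w → Dec (Alive′ w)
    alive′? w = (w ∈? V - p) ×-dec ¬? (w ∈? X)

    alive′ : ∀ {w} → Alive w → w ≢ p → Alive′ w
    alive′ (w∈V , w∉X) w≢p = x∈p∧x≢y⇒x∈p-y w∈V w≢p , w∉X

    walk-avoids-p : ∀ {a u} → a ≢ p → Reach G Alive a u → Component G Alive′ a u ⊎ u ≡ p
    walk-avoids-p a≢p = Sum.map proj₁ proj₁ ∘ Reach-avoiding-leaf alive′ a≢p

    walk-to-p : ∀ {a} → a ≢ p → Reach G Alive a p → Component G Alive′ a q
    walk-to-p a≢p a⇝p with Reach-avoiding-leaf alive′ a≢p a⇝p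
    ... | inj₁ (_ , p≢p)  = contradiction refl p≢p
    ... | inj₂ (_ , a⇝q) = a⇝q

    extend : ∀ {w} {E : Fin n → Set} → Alive′ w → (∀ {u} → E u → Component G Alive′ w u ⊎ u ≡ p) →
             (E p → Component G Alive′ w q) → IsClique G E ⊎ ¬ HasCycle G E
    extend (w∈V-p , w∉X) E⊆ ep⇒ with X-solves _ w∈V-p w∉X
    ... | inj₁ clique = clique-addLeaf q-no△ clique
                          (clique-component-member? G alive′? (w∈V-p , w∉X) clique q) E⊆ ep⇒
    ... | inj₂ tree   = inj₂ (acyclic-addLeaf (proj₂ tree) E⊆)

    cliqueOrAcyclic : ∀ {v} → Alive v →
                      IsClique G (Component G Alive v) ⊎ ¬ HasCycle G (Component G Alive v)
    cliqueOrAcyclic {v} v-alive with v ≟ p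
    ... | no v≢p = extend (alive′ v-alive v≢p) (walk-avoids-p v≢p) (walk-to-p v≢p)
    ... | yes refl with alive? q
    ...   | no q-dead  = inj₁ (subsingleton-isClique G λ p⇝u →
                           [ id , (λ q⇝u → contradiction (Reach-source G q⇝u) q-dead) ]′
                           (Reach-from-leaf p⇝u))
    ...   | yes q-alive = extend (alive′ q-alive q≢p)
                           (λ p⇝u → [ inj₂ , walk-avoids-p q≢p ]′ (Reach-from-leaf p⇝u))
                           (λ _ → here (alive′ q-alive q≢p))

lemma25 : (n : ℕ) (G : MultiGraph n) (k : ℕ) → 1 ≤ k →
    (v₁ v₂ v₃ v₄ : Fin n) →
    v₁ ≢ v₂ → v₁ ≢ v₃ → v₁ ≢ v₄ → v₂ ≢ v₃ → v₂ ≢ v₄ → v₃ ≢ v₄ →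
    Adj G v₁ v₂ → Adj G v₁ v₃ → Adj G v₁ v₄ →
    ¬ Adj G v₂ v₃ → ¬ Adj G v₂ v₄ → ¬ Adj G v₃ v₄ →
    deg G v₁ ≡ 3 → deg G v₄ ≡ 1 →
    YesCTVD G ⊤ k ⇔ YesCTVD G (⊤ - v₄) k
lemma25 n G k _ v₁ v₂ v₃ v₄ _ _ _ v₂≢v₃ v₂≢v₄ v₃≢v₄ v₁–v₂ v₁–v₃ v₁–v₄ v₂≁v₃ v₂≁v₄ v₃≁v₄ deg-v₁ deg-v₄ =
  mk⇔ (YesCTVD-restrict G ⊆⊤)
      (Leaf.YesCTVD-addLeaf G (Adj-sym G v₁–v₄) (≤-reflexive deg-v₄) v₁-on-no-triangle)
  where
  N[v₁] : ∀ {a} → Adj G v₁ a → a ∈ₗ v₂ ∷ v₃ ∷ v₄ ∷ []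
  N[v₁] = neighbours-exhausted G ((v₂≢v₃ ∷ v₂≢v₄ ∷ []) ∷ (v₃≢v₄ ∷ []) ∷ [] ∷ [])
                                   (v₁–v₂ ∷ v₁–v₃ ∷ v₁–v₄ ∷ []) (≤-reflexive deg-v₁)

  v₁-on-no-triangle : OnNoTriangle G v₁
  v₁-on-no-triangle v₁–a v₁–b a≢b a–b with N[v₁] v₁–a | N[v₁] v₁–b
  ... | here refl                 | here refl                 = a≢b refl
  ... | there (here refl)         | there (here refl)         = a≢b refl
  ... | there (there (here refl)) | there (there (here refl)) = a≢b refl
  ... | here refl                 | there (here refl)         = v₂≁v₃ a–b
  ... | here refl                 | there (there (here refl)) = v₂≁v₄ a–b
  ... | there (here refl)         | there (there (here refl)) = v₃≁v₄ a–b
  ... | there (here refl)         | here refl                 = v₂≁v₃ (Adj-sym G a–b)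
  ... | there (there (here refl)) | here refl                 = v₂≁v₄ (Adj-sym G a–b)
  ... | there (there (here refl)) | there (here refl)         = v₃≁v₄ (Adj-sym G a–b)
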